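{- For $k \geq 2$, every arc of a $k$-geodetic digraph is contained in at most one directed cycle of length $k+1$.
   Context: A digraph has a vertex set and an arc set consisting of ordered pairs of distinct vertices. A walk of length $\ell$ is a sequence $x_0x_1\dots x_\ell$ of vertices with $x_i \rightarrow x_{i+1}$ for all $i$. A digraph is $k$-geodetic if for every ordered pair $(u,v)$ of (not necessarily distinct) vertices there is at most one $u,v$-walk of length at most $k$. A directed cycle of length $\ell$ is a sequence of distinct vertices $x_0,\dots,x_{\ell-1}$ with $x_i \rightarrow x_{i+1}$ for $0\le i\le \ell-2$ and $x_{\ell-1}\rightarrow x_0$. -}

module Defs where

open import Data.Nat using (ℕ; zero; suc; _≤_; _+_)
open import Data.Nat.DivMod using (_mod_)
open import Data.Fin using (Fin; toℕ)
open import Data.Vec using (Vec; []; _∷_; head; last)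
open import Data.Product using (Σ; _×_; _,_; ∃)
open import Data.Unit using (⊤)
open import Function.Definitions using (Injective)
open import Relation.Binary.PropositionalEquality using (_≡_)
open import Relation.Nullary using (¬_)

record Digraph (n : ℕ) : Set₁ where
  field
    _⇒_      : Fin n → Fin n → Set
    loopless : ∀ {x} → ¬ (x ⇒ x)

module _ {n : ℕ} (G : Digraph n) where
  open Digraph G

  AllArcs : ∀ {m} → Vec (Fin n) m → Set
  AllArcs []               = ⊤
  AllArcs (x ∷ [])         = ⊤
  AllArcs (x ∷ y ∷ xs)     = (x ⇒ y) × AllArcs (y ∷ xs)

  Walk : Set
  Walk = Σ ℕ (λ ℓ → Vec (Fin n) (suc ℓ))

  len : Walk → ℕ
  len (ℓ , _) = ℓ

  IsWalk : Fin n → Fin n → Walk → Set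
  IsWalk u v (ℓ , xs) = (head xs ≡ u) × (last xs ≡ v) × AllArcs xs

  Geodetic : ℕ → Set
  Geodetic k = ∀ (u v : Fin n) (w w′ : Walk) →
    IsWalk u v w → len w ≤ k →
    IsWalk u v w′ → len w′ ≤ k →
    w ≡ w′

  next : ∀ {m} → Fin (suc m) → Fin (suc m)
  next {m} i = (suc (toℕ i)) mod (suc m)

  record Cycle (m : ℕ) : Set where
    field
      vtx      : Fin (suc m) → Fin n
      distinct : Injective _≡_ _≡_ vtx
      arcs     : ∀ i → vtx i ⇒ vtx (next i)
  open Cycle public

  ContainsArc : ∀ {m} → Cycle m → Fin n → Fin n → Set
  ContainsArc {m} C a b = Σ (Fin (suc m)) λ i → (vtx C i ≡ a) × (vtx C (next i) ≡ b)

  SameCycle : ∀ {m} → Cycle m → Cycle m → Set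
  SameCycle {m} C D = Σ ℕ λ r → ∀ (i : Fin (suc m)) →
    vtx D i ≡ vtx C ((toℕ i + r) mod (suc m))

-- Going once around a directed (k+1)-cycle through the arc a → b, starting
-- after the arc, is a b,a-walk of length k. In a k-geodetic digraph there is
-- only one such walk, so two (k+1)-cycles through a → b visit the same
-- vertices in the same order from b onwards, i.e. one is a rotation of the
-- other.
module Submission where

open import Defs
open import Data.Nat using (ℕ; zero; suc; _+_; _∸_; _%_; _≤_; NonZero)
open import Data.Nat.Properties
  using (≤-refl; +-identityʳ; +-suc; ≡-irrelevant; m+[n∸m]≡n; +-commutativeSemigroup)
open import Data.Nat.DivMod
  using (_mod_; m%n<n; m%n%n≡m%n; [m+n]%n≡m%n; %-distribˡ-+; m<n⇒m%n≡m)
open import Data.Fin using (Fin; toℕ)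
open import Data.Fin.Properties using (toℕ-fromℕ<; toℕ-injective; toℕ<n; toℕ≤pred[n])
open import Data.Vec using (Vec; []; _∷_; head; last; lookup)
open import Data.Product using (_,_)
open import Data.Product.Properties using (,-injectiveʳ-UIP)
open import Data.Unit using (tt)
open import Algebra.Properties.CommutativeSemigroup +-commutativeSemigroup
  using (x∙yz≈y∙xz)
open import Relation.Binary.PropositionalEquality
  using (_≡_; refl; sym; trans; cong; subst; module ≡-Reasoning)

open ≡-Reasoning

toℕ-mod : ∀ m d .{{_ : NonZero d}} → toℕ (m mod d) ≡ m % d
toℕ-mod m d = toℕ-fromℕ< (m%n<n m d)

[m+n%d]%d≡[m+n]%d : ∀ m n d .{{_ : NonZero d}} → (m + n % d) % d ≡ (m + n) % d
[m+n%d]%d≡[m+n]%d m n d = begin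
  (m + n % d) % d           ≡⟨ %-distribˡ-+ m (n % d) d ⟩
  (m % d + n % d % d) % d   ≡⟨ cong (λ r → (m % d + r) % d) (m%n%n≡m%n n d) ⟩
  (m % d + n % d) % d       ≡⟨ %-distribˡ-+ m n d ⟨
  (m + n) % d               ∎

segment : {A : Set} → (ℕ → A) → ℕ → (m : ℕ) → Vec A (suc m)
segment f s zero    = f s ∷ []
segment f s (suc m) = f s ∷ segment f (suc s) m

module _ {A : Set} (f : ℕ → A) where

  head-segment : ∀ s m → head (segment f s m) ≡ f s
  head-segment s zero    = refl
  head-segment s (suc m) = refl

  last-segment : ∀ s m → last (segment f s m) ≡ f (s + m)
  last-segment s zero    = cong f (sym (+-identityʳ s))
  last-segment s (suc m) = trans (last-segment (suc s) m) (cong f (sym (+-suc s m)))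

  lookup-segment : ∀ s m (t : Fin (suc m)) → lookup (segment f s m) t ≡ f (s + toℕ t)
  lookup-segment s zero    Fin.zero    = cong f (sym (+-identityʳ s))
  lookup-segment s (suc m) Fin.zero    = cong f (sym (+-identityʳ s))
  lookup-segment s (suc m) (Fin.suc t) = trans (lookup-segment (suc s) m t) (cong f (sym (+-suc s (toℕ t))))

module _ {n : ℕ} (G : Digraph n) where
  open Digraph G

  segment-arcs : (f : ℕ → Fin n) → (∀ t → f t ⇒ f (suc t)) →
    ∀ s m → AllArcs G (segment f s m)
  segment-arcs f arc s zero          = tt
  segment-arcs f arc s (suc zero)    = arc s , tt
  segment-arcs f arc s (suc (suc m)) = arc s , segment-arcs f arc (suc s) (suc m)

  module _ {k : ℕ} (C : Cycle G k) where

    around : ℕ → Fin n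
    around t = vtx C (t mod suc k)

    around-cong-% : ∀ t u → t % suc k ≡ u % suc k → around t ≡ around u
    around-cong-% t u eq = cong (vtx C) (toℕ-injective (begin
      toℕ (t mod suc k)   ≡⟨ toℕ-mod t (suc k) ⟩
      t % suc k           ≡⟨ eq ⟩
      u % suc k           ≡⟨ toℕ-mod u (suc k) ⟨
      toℕ (u mod suc k)   ∎))

    around-toℕ : ∀ i → around (toℕ i) ≡ vtx C i
    around-toℕ i = cong (vtx C) (toℕ-injective
      (trans (toℕ-mod (toℕ i) (suc k)) (m<n⇒m%n≡m (toℕ<n i))))

    around-+-mod : ∀ s t → around (s + toℕ (t mod suc k)) ≡ around (s + t)
    around-+-mod s t = around-cong-% (s + toℕ (t mod suc k)) (s + t) (begin
      (s + toℕ (t mod suc k)) % suc k   ≡⟨ cong (λ r → (s + r) % suc k) (toℕ-mod t (suc k)) ⟩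
      (s + t % suc k) % suc k           ≡⟨ [m+n%d]%d≡[m+n]%d s t (suc k) ⟩
      (s + t) % suc k                   ∎)

    around-arc : ∀ t → around t ⇒ around (suc t)
    around-arc t = subst (around t ⇒_) (around-+-mod 1 t) (arcs C (t mod suc k))

    closingWalk : Fin (suc k) → Walk G
    closingWalk i = k , segment around (suc (toℕ i)) k

    closingWalk-isWalk : ∀ {i a b} → vtx C i ≡ a → vtx C (next G i) ≡ b →
      IsWalk G b a (closingWalk i)
    closingWalk-isWalk {i} refl refl =
      head-segment around (suc (toℕ i)) k ,
      trans (last-segment around (suc (toℕ i)) k) returns ,
      segment-arcs around around-arc (suc (toℕ i)) k
      where
      returns : around (suc (toℕ i) + k) ≡ vtx C i
      returns = begin
        around (suc (toℕ i + k))   ≡⟨ cong around (+-suc (toℕ i) k) ⟨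
        around (toℕ i + suc k)     ≡⟨ around-cong-% (toℕ i + suc k) (toℕ i) ([m+n]%n≡m%n (toℕ i) (suc k)) ⟩
        around (toℕ i)             ≡⟨ around-toℕ i ⟩
        vtx C i                    ∎

  closingWalk-≡⇒around-shift : ∀ {k} (C D : Cycle G k) {i j} →
    closingWalk C i ≡ closingWalk D j →
    ∀ t → around C (suc (toℕ i) + t) ≡ around D (suc (toℕ j) + t)
  closingWalk-≡⇒around-shift {k} C D {i} {j} eq t = begin
    around C (suc (toℕ i) + t)                      ≡⟨ around-+-mod C (suc (toℕ i)) t ⟨
    around C (suc (toℕ i) + toℕ t′)                 ≡⟨ lookup-segment (around C) (suc (toℕ i)) k t′ ⟨
    lookup (segment (around C) (suc (toℕ i)) k) t′  ≡⟨ cong (λ xs → lookup xs t′) (,-injectiveʳ-UIP ≡-irrelevant eq) ⟩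
    lookup (segment (around D) (suc (toℕ j)) k) t′  ≡⟨ lookup-segment (around D) (suc (toℕ j)) k t′ ⟩
    around D (suc (toℕ j) + toℕ t′)                 ≡⟨ around-+-mod D (suc (toℕ j)) t ⟩
    around D (suc (toℕ j) + t)                      ∎
    where
    t′ : Fin (suc k)
    t′ = t mod suc k

lemma24 : (n k : ℕ) → 2 ≤ k → (G : Digraph n) → Geodetic G k →
    (a b : Fin n) → (C D : Cycle G k) →
    ContainsArc G C a b → ContainsArc G D a b → SameCycle G C D
lemma24 n k _ G geodetic a b C D (i , Cia , Cib) (j , Dja , Djb) =
  suc (toℕ i) + (k ∸ toℕ j) , rotation
  where
  sameWalk : closingWalk G C i ≡ closingWalk G D j
  sameWalk = geodetic b a _ _
    (closingWalk-isWalk G C Cia Cib) ≤-refl (closingWalk-isWalk G D Dja Djb) ≤-refl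

  rotation : ∀ x → vtx D x ≡ vtx C ((toℕ x + (suc (toℕ i) + (k ∸ toℕ j))) mod suc k)
  rotation x = begin
    vtx D x                                         ≡⟨ around-toℕ G D x ⟨
    around G D (toℕ x)                              ≡⟨ around-cong-% G D (toℕ x) (toℕ x + suc k) (sym ([m+n]%n≡m%n (toℕ x) (suc k))) ⟩
    around G D (toℕ x + suc k)                      ≡⟨ cong (λ r → around G D (toℕ x + suc r)) (m+[n∸m]≡n (toℕ≤pred[n] j)) ⟨
    around G D (toℕ x + (suc (toℕ j) + (k ∸ toℕ j))) ≡⟨ cong (around G D) (x∙yz≈y∙xz (toℕ x) (suc (toℕ j)) _) ⟩
    around G D (suc (toℕ j) + (toℕ x + (k ∸ toℕ j))) ≡⟨ closingWalk-≡⇒around-shift G C D sameWalk _ ⟨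
    around G C (suc (toℕ i) + (toℕ x + (k ∸ toℕ j))) ≡⟨ cong (around G C) (x∙yz≈y∙xz (suc (toℕ i)) (toℕ x) _) ⟩
    around G C (toℕ x + (suc (toℕ i) + (k ∸ toℕ j))) ∎
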